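{- Let $G$ be a small crowned graph with head $H$ and crown $C$, let $M$ be a perfect matching of $G$ consisting of edges between $H$ and $C$, let $X_0\subseteq H$, and let $(F,\bar F)=\mathrm{prop}_{\mathrm{dir}}(G,M,X_0)$. Let $H'=H\setminus F$, $C'=C\setminus\bar F$ and $G'=G[H'\cup C']$. Then: (1) $F\subseteq H$, $\bar F\subseteq C$, $\bar F=M_V(F)$, and every $S\in\mathrm{Sol}(G)$ with $X_0\subseteq S$ satisfies $F\subseteq S$ and $S\cap\bar F=\emptyset$; (2) for every $S\in\mathrm{Sol}(G)$ with $X_0\subseteq S$, $G'$ is a small crowned graph (with head $H'$ and crown $C'$) and $S\cap(C'\cup H')\in\mathrm{Sol}(G')$; (3) for every $S'\in\mathrm{Sol}(G')$, the set $F\cup S'$ belongs to $\mathrm{Sol}(G)$ and contains $X_0$.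
   Context: A crowned graph is a graph whose vertex set is partitioned into $H\cup C$ (head $H$, crown $C$) such that $C$ is an independent set and there is a matching consisting of edges between $H$ and $C$ of size $|H|$. It is small if $|H|=|C|$. For a small crowned graph $G$, $\mathrm{Sol}(G)$ denotes the set of vertex covers of $G$ of size exactly $|H|$. For a matching $M$ and $T\subseteq V(M)$ containing at most one endpoint of each edge of $M$, $M_V(T)=\{v' : vv'\in M, v\in T\}$ is the image of $T$ under $M$. $\mathrm{prop}_{\mathrm{dir}}(G,M,X_0)$: form the directed bipartite graph on $H\cup C$ in which every edge of $M$ is oriented from its $H$-endpoint to its $C$-endpoint and every other edge of $G$ between $H$ and $C$ is oriented from its $C$-endpoint to its $H$-endpoint (edges inside $H$ are not used). Let $Z$ be the set of vertices reachable from $X_0$ in this directed graph (including $X_0$). Output $(F,\bar F)=(Z\cap H, Z\cap C)$. -}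

module Defs where

open import Data.Nat using (ℕ)
open import Data.Fin using (Fin)
open import Data.Fin.Subset using (Subset; _∈_; _∉_; _⊆_; _∩_; _∪_; _─_; ∣_∣; ⊤)
open import Data.Product using (Σ; ∃; ∃-syntax; _×_; _,_)
open import Data.Sum using (_⊎_)
open import Relation.Nullary using (¬_)
open import Relation.Binary.PropositionalEquality using (_≡_)
open import Relation.Binary.Definitions using (Decidable)
open import Relation.Binary.Construct.Closure.ReflexiveTransitive using (Star)
open import Function.Bundles using (_⇔_)

record Graph (n : ℕ) : Set₁ where
  field
    _~_    : Fin n → Fin n → Set
    ~-dec  : Decidable _~_
    ~-sym  : ∀ {u v} → u ~ v → v ~ u
    ~-irr  : ∀ {v} → ¬ (v ~ v)

open Graph public

-- An (undirected) edge set is encoded as a symmetric relation on vertices.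
EdgeSet : ℕ → Set₁
EdgeSet n = Fin n → Fin n → Set

record IsMatching {n : ℕ} (G : Graph n) (M : EdgeSet n) : Set where
  field
    M-sym   : ∀ {u v} → M u v → M v u
    M-edge  : ∀ {u v} → M u v → _~_ G u v
    M-func  : ∀ {u v w} → M u v → M u w → v ≡ w

BetweenHC : {n : ℕ} → EdgeSet n → Subset n → Subset n → Set
BetweenHC M H C = ∀ u v → M u v → (u ∈ H × v ∈ C) ⊎ (u ∈ C × v ∈ H)

Saturates : {n : ℕ} → EdgeSet n → Subset n → Set
Saturates M T = ∀ v → v ∈ T → ∃[ w ] M v w

-- Induced subgraphs G[V] are represented by the pair (G , V), V : Subset n.

Partition : {n : ℕ} → Subset n → Subset n → Subset n → Set
Partition V H C = (∀ v → v ∈ V ⇔ (v ∈ H ⊎ v ∈ C)) × (∀ v → v ∈ H → v ∉ C)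

Independent : {n : ℕ} → Graph n → Subset n → Set
Independent G C = ∀ u v → u ∈ C → v ∈ C → ¬ (_~_ G u v)

-- G[V] is a crowned graph with head H and crown C:
-- V = H ∪ C (disjointly), C independent, and a matching of edges between H and C
-- of size |H| (i.e. one saturating H, since every such edge has exactly one endpoint in H).
Crowned : {n : ℕ} → Graph n → Subset n → Subset n → Subset n → Set₁
Crowned G V H C =
  Partition V H C × Independent G C ×
  (∃[ M ] (IsMatching G M × BetweenHC M H C × Saturates M H))

SmallCrowned : {n : ℕ} → Graph n → Subset n → Subset n → Subset n → Set₁
SmallCrowned G V H C = Crowned G V H C × ∣ H ∣ ≡ ∣ C ∣

IsVertexCover : {n : ℕ} → Graph n → Subset n → Subset n → Set
IsVertexCover G V S =
  S ⊆ V × (∀ u v → u ∈ V → v ∈ V → _~_ G u v → u ∈ S ⊎ v ∈ S)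

Sol : {n : ℕ} → Graph n → Subset n → Subset n → Subset n → Set
Sol G V H S = IsVertexCover G V S × ∣ S ∣ ≡ ∣ H ∣

IsImage : {n : ℕ} → EdgeSet n → Subset n → Subset n → Set
IsImage M T T' = ∀ v' → v' ∈ T' ⇔ (∃[ v ] (v ∈ T × M v v'))

Arc : {n : ℕ} → Graph n → EdgeSet n → Subset n → Subset n → Fin n → Fin n → Set
Arc G M H C u v =
  (M u v × u ∈ H × v ∈ C) ⊎ (_~_ G u v × ¬ M u v × u ∈ C × v ∈ H)

Reachable : {n : ℕ} → Graph n → EdgeSet n → Subset n → Subset n → Subset n → Fin n → Set
Reachable G M H C X₀ v = ∃[ u ] (u ∈ X₀ × Star (Arc G M H C) u v)

PropDir : {n : ℕ} → Graph n → EdgeSet n → Subset n → Subset n → Subset n →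
          Subset n → Subset n → Set
PropDir G M H C X₀ F F̄ =
  ∃[ Z ] ((∀ v → v ∈ Z ⇔ Reachable G M H C X₀ v) × F ≡ Z ∩ H × F̄ ≡ Z ∩ C)

{-# OPTIONS --safe #-}
-- Matching edges are arcs H → C and all other edges arcs C → H, so a crown vertex can only be
-- reached from its partner: the reachable set Z is closed under the matching, whence F̄ = M_V(F)
-- and |F| = |F̄|. A solution S has |S| = n/2 and covers the n/2 disjoint matching edges, so it
-- contains exactly one endpoint of each; following the arcs from X₀ ⊆ S this puts the head part of Z
-- inside S and the crown part outside. Conversely every neighbour of F̄ lies in F, so F together
-- with a solution of G − Z covers G, and the sizes add up because |F| = |F̄|.
module Submission where

open import Data.Nat using (ℕ; suc; _+_; _≤_; _<_)
open import Data.Nat.Properties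
  using (+-suc; +-comm; +-identityʳ; +-cancelʳ-≡; <-irrefl; m<m+n; ≤-reflexive; +-0-commutativeMonoid; module ≤-Reasoning)
open import Data.Fin using (Fin; _≟_)
open import Data.Fin.Subset using (Subset; Side; inside; outside; _∈_; _∉_; _⊆_; _∩_; _∪_; _─_; ∣_∣; ⊤; ⊥; ⁅_⁆; Empty)
open import Data.Fin.Subset.Properties
  using (_∈?_; ∈⊤; ⊆⊤; ⊆-antisym; Empty-unique; ∣⊥∣≡0; ∣⊤∣≡n; ∣⁅x⁆∣≡1; x∈⁅y⁆⇒x≡y; p⊆q⇒∣p∣≤∣q∣;
         x∈p∩q⁺; x∈p∩q⁻; x∈p∪q⁺; x∈p∪q⁻; x∈p∧x∉q⇒x∈p─q; p─q⊆p; p∩q⊆p; p∩q⊆q; ∪-comm)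
open import Data.Fin.Permutation using (Permutation′; _⟨$⟩ʳ_; permutation)
open import Data.Product using (∃-syntax; _×_; _,_; proj₁; proj₂; uncurry)
open import Data.Sum using (_⊎_; inj₁; inj₂; [_,_]′)
import Data.Sum as Sum
open import Data.Vec using (_∷_; []; lookup; tabulate; here; there)
open import Data.Vec.Properties using ([]=⇒lookup; lookup⇒[]=; lookup∘tabulate)
open import Relation.Nullary using (yes; no; contradiction)
open import Relation.Binary.PropositionalEquality
  using (_≡_; refl; sym; trans; cong; cong₂; subst; module ≡-Reasoning)
open import Relation.Binary.Construct.Closure.ReflexiveTransitive using (ε; _◅_; _◅◅_; fold)
open import Function using (_∘_; id)
open import Function.Bundles using (_⇔_; mk⇔; Equivalence)
open import Algebra.Properties.CommutativeMonoid.Sum +-0-commutativeMonoid using (sum-syntax; sum-cong-≗; ∑-permute)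
open import Defs

open Equivalence using (to; from)

private
  variable
    n : ℕ
    p q r : Subset n

x∈p─q⇒x∉q : ∀ {x} (p q : Subset n) → x ∈ p ─ q → x ∉ q
x∈p─q⇒x∉q (_       ∷ p) (_ ∷ q) (there x∈p─q) (there x∈q) = x∈p─q⇒x∉q p q x∈p─q x∈q
x∈p─q⇒x∉q (inside  ∷ p) (_ ∷ q) ()            here
x∈p─q⇒x∉q (outside ∷ p) (_ ∷ q) ()            here

∣p∪q∣+∣p∩q∣≡∣p∣+∣q∣ : ∀ (p q : Subset n) → ∣ p ∪ q ∣ + ∣ p ∩ q ∣ ≡ ∣ p ∣ + ∣ q ∣
∣p∪q∣+∣p∩q∣≡∣p∣+∣q∣ []            []            = refl
∣p∪q∣+∣p∩q∣≡∣p∣+∣q∣ (inside  ∷ p) (inside  ∷ q) = begin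
  suc (∣ p ∪ q ∣ + suc ∣ p ∩ q ∣)   ≡⟨ cong suc (+-suc ∣ p ∪ q ∣ ∣ p ∩ q ∣) ⟩
  suc (suc (∣ p ∪ q ∣ + ∣ p ∩ q ∣)) ≡⟨ cong (suc ∘ suc) (∣p∪q∣+∣p∩q∣≡∣p∣+∣q∣ p q) ⟩
  suc (suc (∣ p ∣ + ∣ q ∣))         ≡⟨ cong suc (sym (+-suc ∣ p ∣ ∣ q ∣)) ⟩
  suc (∣ p ∣ + suc ∣ q ∣)           ∎
  where open ≡-Reasoning
∣p∪q∣+∣p∩q∣≡∣p∣+∣q∣ (inside  ∷ p) (outside ∷ q) = cong suc (∣p∪q∣+∣p∩q∣≡∣p∣+∣q∣ p q)
∣p∪q∣+∣p∩q∣≡∣p∣+∣q∣ (outside ∷ p) (inside  ∷ q) =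
  trans (cong suc (∣p∪q∣+∣p∩q∣≡∣p∣+∣q∣ p q)) (sym (+-suc ∣ p ∣ ∣ q ∣))
∣p∪q∣+∣p∩q∣≡∣p∣+∣q∣ (outside ∷ p) (outside ∷ q) = ∣p∪q∣+∣p∩q∣≡∣p∣+∣q∣ p q

∣p∪q∣≡∣p∣+∣q∣ : ∀ (p q : Subset n) → Empty (p ∩ q) → ∣ p ∪ q ∣ ≡ ∣ p ∣ + ∣ q ∣
∣p∪q∣≡∣p∣+∣q∣ {n} p q p∩q-empty = begin
  ∣ p ∪ q ∣             ≡⟨ sym (+-identityʳ _) ⟩
  ∣ p ∪ q ∣ + 0         ≡⟨ cong (∣ p ∪ q ∣ +_) (sym (∣⊥∣≡0 n)) ⟩
  ∣ p ∪ q ∣ + ∣ ⊥ {n} ∣ ≡⟨ cong (λ s → ∣ p ∪ q ∣ + ∣ s ∣) (sym (Empty-unique p∩q-empty)) ⟩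
  ∣ p ∪ q ∣ + ∣ p ∩ q ∣ ≡⟨ ∣p∪q∣+∣p∩q∣≡∣p∣+∣q∣ p q ⟩
  ∣ p ∣ + ∣ q ∣         ∎
  where open ≡-Reasoning

Partition⇒∣p∣+∣q∣≡∣r∣ : Partition r p q → ∣ p ∣ + ∣ q ∣ ≡ ∣ r ∣
Partition⇒∣p∣+∣q∣≡∣r∣ {r = r} {p = p} {q = q} (r⇔p⊎q , p∌q) = begin
  ∣ p ∣ + ∣ q ∣  ≡⟨ sym (∣p∪q∣≡∣p∣+∣q∣ p q λ (x , x∈p∩q) → uncurry (p∌q x) (x∈p∩q⁻ p q x∈p∩q)) ⟩
  ∣ p ∪ q ∣      ≡⟨ cong ∣_∣ (⊆-antisym (λ {x} x∈ → from (r⇔p⊎q x) (x∈p∪q⁻ p q x∈))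
                                        (λ {x} x∈ → x∈p∪q⁺ (to (r⇔p⊎q x) x∈))) ⟩
  ∣ r ∣          ∎
  where open ≡-Reasoning

⊆⇒Partition-─ : q ⊆ p → Partition p (p ─ q) q
⊆⇒Partition-─ {q = q} {p = p} q⊆p = (λ x → mk⇔ (split x) [ p─q⊆p p q , q⊆p ]′) , λ x → x∈p─q⇒x∉q p q
  where
  split : ∀ x → x ∈ p → x ∈ p ─ q ⊎ x ∈ q
  split x x∈p with x ∈? q
  ... | yes x∈q = inj₂ x∈q
  ... | no  x∉q = inj₁ (x∈p∧x∉q⇒x∈p─q x∈p x∉q)

private
  𝟙 : Side → ℕ
  𝟙 inside  = 1
  𝟙 outside = 0

  ∣p∣≡∑𝟙 : ∀ (p : Subset n) → ∣ p ∣ ≡ ∑[ i < n ] 𝟙 (lookup p i)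
  ∣p∣≡∑𝟙 []            = refl
  ∣p∣≡∑𝟙 (inside  ∷ p) = cong suc (∣p∣≡∑𝟙 p)
  ∣p∣≡∑𝟙 (outside ∷ p) = ∣p∣≡∑𝟙 p

  lookup-cong : ∀ {i j} → (i ∈ p ⇔ j ∈ q) → lookup p i ≡ lookup q j
  lookup-cong {p = p} {q = q} {i = i} {j = j} i∈p⇔j∈q with lookup p i in p[i] | lookup q j in q[j]
  ... | inside  | inside  = refl
  ... | outside | outside = refl
  ... | inside  | outside = trans (sym ([]=⇒lookup (to i∈p⇔j∈q (lookup⇒[]= i p p[i])))) q[j]
  ... | outside | inside  = trans (sym p[i]) ([]=⇒lookup (from i∈p⇔j∈q (lookup⇒[]= j q q[j])))

∣∣-permute : ∀ (π : Permutation′ n) → (∀ i → i ∈ p ⇔ π ⟨$⟩ʳ i ∈ q) → ∣ p ∣ ≡ ∣ q ∣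
∣∣-permute {n} {p = p} {q = q} π p⇔q∘π = begin
  ∣ p ∣                              ≡⟨ ∣p∣≡∑𝟙 p ⟩
  ∑[ i < n ] 𝟙 (lookup p i)          ≡⟨ sum-cong-≗ (λ i → cong 𝟙 (lookup-cong (p⇔q∘π i))) ⟩
  ∑[ i < n ] 𝟙 (lookup q (π ⟨$⟩ʳ i)) ≡⟨ sym (∑-permute (𝟙 ∘ lookup q) π) ⟩
  ∑[ i < n ] 𝟙 (lookup q i)          ≡⟨ sym (∣p∣≡∑𝟙 q) ⟩
  ∣ q ∣                              ∎
  where open ≡-Reasoning

preimage : (Fin n → Fin n) → Subset n → Subset n
preimage f p = tabulate (lookup p ∘ f)

∈preimage⇔ : ∀ (f : Fin n → Fin n) p {i} → i ∈ preimage f p ⇔ f i ∈ p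
∈preimage⇔ f p {i} = mk⇔
  (λ i∈ → lookup⇒[]= (f i) p (trans (sym (lookup∘tabulate (lookup p ∘ f) i)) ([]=⇒lookup i∈)))
  (λ fi∈ → lookup⇒[]= i (preimage f p) (trans (lookup∘tabulate (lookup p ∘ f) i) ([]=⇒lookup fi∈)))

x∈p⇒0<∣p∣ : ∀ {x} → x ∈ p → 0 < ∣ p ∣
x∈p⇒0<∣p∣ {p = p} {x} x∈p = begin
  1         ≡⟨ sym (∣⁅x⁆∣≡1 x) ⟩
  ∣ ⁅ x ⁆ ∣ ≤⟨ p⊆q⇒∣p∣≤∣q∣ (λ y∈⁅x⁆ → subst (_∈ p) (sym (x∈⁅y⁆⇒x≡y x y∈⁅x⁆)) x∈p) ⟩
  ∣ p ∣     ∎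
  where open ≤-Reasoning

cover-of-pairs⇒∉ : ∀ (π : Permutation′ n) (S : Subset n) → (∀ i → i ∈ S ⊎ π ⟨$⟩ʳ i ∈ S) →
                   ∣ S ∣ + ∣ S ∣ ≤ n → ∀ {i} → i ∈ S → π ⟨$⟩ʳ i ∉ S
cover-of-pairs⇒∉ {n} π S covers ∣S∣+∣S∣≤n {i} i∈S πi∈S = <-irrefl refl (begin-strict
  n                       ≡⟨ sym (∣⊤∣≡n n) ⟩
  ∣ ⊤ {n} ∣               ≤⟨ p⊆q⇒∣p∣≤∣q∣ {p = ⊤} (λ {x} _ → x∈p∪q⁺ (Sum.map₂ (from (∈preimage⇔ _ S)) (covers x))) ⟩
  ∣ S ∪ T ∣               <⟨ m<m+n ∣ S ∪ T ∣ (x∈p⇒0<∣p∣ (x∈p∩q⁺ (i∈S , from (∈preimage⇔ _ S) πi∈S))) ⟩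
  ∣ S ∪ T ∣ + ∣ S ∩ T ∣   ≡⟨ ∣p∪q∣+∣p∩q∣≡∣p∣+∣q∣ S T ⟩
  ∣ S ∣ + ∣ T ∣           ≡⟨ cong (∣ S ∣ +_) (∣∣-permute π (λ _ → ∈preimage⇔ _ S)) ⟩
  ∣ S ∣ + ∣ S ∣           ≤⟨ ∣S∣+∣S∣≤n ⟩
  n                       ∎)
  where
  T = preimage (π ⟨$⟩ʳ_) S
  open ≤-Reasoning

module PerfectMatching {G : Graph n} {M : EdgeSet n} (isM : IsMatching G M) (saturated : Saturates M ⊤) where
  open IsMatching isM

  partner : Fin n → Fin n
  partner v = proj₁ (saturated v ∈⊤)

  M-partner : ∀ v → M v (partner v)
  M-partner v = proj₂ (saturated v ∈⊤)

  M⇒≡partner : ∀ {u v} → M u v → v ≡ partner u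
  M⇒≡partner Muv = M-func Muv (M-partner _)

  partner-involutive : ∀ v → partner (partner v) ≡ v
  partner-involutive v = sym (M⇒≡partner (M-sym (M-partner v)))

  partner-permutation : Permutation′ n
  partner-permutation = permutation partner partner partner-involutive partner-involutive

  IsVertexCover⇒partner∉ : ∀ {S} → IsVertexCover G ⊤ S → ∣ S ∣ + ∣ S ∣ ≤ n →
                           ∀ {v} → v ∈ S → partner v ∉ S
  IsVertexCover⇒partner∉ {S} (_ , covers) =
    cover-of-pairs⇒∉ partner-permutation S (λ v → covers v (partner v) ∈⊤ ∈⊤ (M-edge (M-partner v)))

  module _ {H C : Subset n} (H∌C : ∀ v → v ∈ H → v ∉ C) (M-between : BetweenHC M H C) where

    partner-H : ∀ {v} → v ∈ H → partner v ∈ C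
    partner-H {v} v∈H with M-between v (partner v) (M-partner v)
    ... | inj₁ (_ , pv∈C) = pv∈C
    ... | inj₂ (v∈C , _)  = contradiction v∈C (H∌C v v∈H)

    partner-C : ∀ {v} → v ∈ C → partner v ∈ H
    partner-C {v} v∈C with M-between v (partner v) (M-partner v)
    ... | inj₁ (v∈H , _)  = contradiction v∈C (H∌C v v∈H)
    ... | inj₂ (_ , pv∈H) = pv∈H

module _ (G : Graph n) where

  Crowned-restrict : ∀ {H C H′ C′ : Subset n} {M : EdgeSet n} →
    (∀ v → v ∈ H → v ∉ C) → Independent G C → IsMatching G M → BetweenHC M H C →
    H′ ⊆ H → C′ ⊆ C → (∀ {h} → h ∈ H′ → ∃[ c ] (c ∈ C′ × M h c)) →
    Crowned G (H′ ∪ C′) H′ C′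
  Crowned-restrict {H = H} {C} {H′} {C′} {M} H∌C indep isM M-between H′⊆H C′⊆C matched =
    ((λ _ → mk⇔ (x∈p∪q⁻ H′ C′) x∈p∪q⁺) , (λ v v∈H′ v∈C′ → H∌C v (H′⊆H v∈H′) (C′⊆C v∈C′))) ,
    (λ u v u∈C′ v∈C′ → indep u v (C′⊆C u∈C′) (C′⊆C v∈C′)) ,
    M′ , isM′ , M′-between , M′-saturates
    where
    open IsMatching isM
    V′ = H′ ∪ C′

    M′ : EdgeSet n
    M′ u v = M u v × u ∈ V′ × v ∈ V′

    isM′ : IsMatching G M′
    isM′ = record
      { M-sym  = λ (Muv , u∈V′ , v∈V′) → M-sym Muv , v∈V′ , u∈V′
      ; M-edge = λ (Muv , _) → M-edge Muv
      ; M-func = λ (Muv , _) (Muw , _) → M-func Muv Muw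
      }

    ∈V′∩H⇒∈H′ : ∀ {v} → v ∈ V′ → v ∈ H → v ∈ H′
    ∈V′∩H⇒∈H′ {v} v∈V′ v∈H = [ id , (λ v∈C′ → contradiction (C′⊆C v∈C′) (H∌C v v∈H)) ]′ (x∈p∪q⁻ H′ C′ v∈V′)

    ∈V′∩C⇒∈C′ : ∀ {v} → v ∈ V′ → v ∈ C → v ∈ C′
    ∈V′∩C⇒∈C′ {v} v∈V′ v∈C = [ (λ v∈H′ → contradiction v∈C (H∌C v (H′⊆H v∈H′))) , id ]′ (x∈p∪q⁻ H′ C′ v∈V′)

    M′-between : BetweenHC M′ H′ C′
    M′-between u v (Muv , u∈V′ , v∈V′) with M-between u v Muv
    ... | inj₁ (u∈H , v∈C) = inj₁ (∈V′∩H⇒∈H′ u∈V′ u∈H , ∈V′∩C⇒∈C′ v∈V′ v∈C)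
    ... | inj₂ (u∈C , v∈H) = inj₂ (∈V′∩C⇒∈C′ u∈V′ u∈C , ∈V′∩H⇒∈H′ v∈V′ v∈H)

    M′-saturates : Saturates M′ H′
    M′-saturates h h∈H′ with matched h∈H′
    ... | c , c∈C′ , Mhc = c , Mhc , x∈p∪q⁺ (inj₁ h∈H′) , x∈p∪q⁺ (inj₂ c∈C′)

  IsVertexCover-∩ : ∀ {V V′ S : Subset n} → IsVertexCover G V S → V′ ⊆ V → IsVertexCover G V′ (S ∩ V′)
  IsVertexCover-∩ {V′ = V′} {S} (_ , covers) V′⊆V =
    p∩q⊆q S V′ ,
    λ u v u∈V′ v∈V′ u~v →
      Sum.map (λ u∈S → x∈p∩q⁺ (u∈S , u∈V′)) (λ v∈S → x∈p∩q⁺ (v∈S , v∈V′))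
              (covers u v (V′⊆V u∈V′) (V′⊆V v∈V′) u~v)

  IsVertexCover-∪ : ∀ {V S F : Subset n} → IsVertexCover G V S →
    (∀ {u v} → u ∉ V → _~_ G u v → u ∈ F ⊎ v ∈ F) → IsVertexCover G ⊤ (F ∪ S)
  IsVertexCover-∪ {V} {S} {F} (_ , covers) leaving = ⊆⊤ , cover
    where
    cover : ∀ u v → u ∈ ⊤ → v ∈ ⊤ → _~_ G u v → u ∈ F ∪ S ⊎ v ∈ F ∪ S
    cover u v _ _ u~v with u ∈? V | v ∈? V
    ... | yes u∈V | yes v∈V = Sum.map (x∈p∪q⁺ ∘ inj₂) (x∈p∪q⁺ ∘ inj₂) (covers u v u∈V v∈V u~v)
    ... | no u∉V  | _       = Sum.map (x∈p∪q⁺ ∘ inj₁) (x∈p∪q⁺ ∘ inj₁) (leaving u∉V u~v)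
    ... | _       | no v∉V  = Sum.swap (Sum.map (x∈p∪q⁺ ∘ inj₁) (x∈p∪q⁺ ∘ inj₁) (leaving v∉V (~-sym G u~v)))

module PropDirProperties
  {G : Graph n} {H C : Subset n} (partition : Partition ⊤ H C) (indep : Independent G C)
  {M : EdgeSet n} (isM : IsMatching G M) (M-between : BetweenHC M H C) (saturated : Saturates M ⊤)
  {X₀ : Subset n} (X₀⊆H : X₀ ⊆ H)
  {Z : Subset n} (∈Z⇔reachable : ∀ v → v ∈ Z ⇔ Reachable G M H C X₀ v)
  where

  open PerfectMatching isM saturated
  open IsMatching isM using (M-sym)

  _⟶_ : Fin n → Fin n → Set
  _⟶_ = Arc G M H C

  H∌C : ∀ v → v ∈ H → v ∉ C
  H∌C = proj₂ partition

  H⊎C : ∀ v → v ∈ H ⊎ v ∈ C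
  H⊎C v = to (proj₁ partition v) ∈⊤

  F F̄ H′ C′ V′ : Subset n
  F  = Z ∩ H
  F̄  = Z ∩ C
  H′ = H ─ F
  C′ = C ─ F̄
  V′ = H′ ∪ C′

  X₀⊆Z : X₀ ⊆ Z
  X₀⊆Z {x} x∈X₀ = from (∈Z⇔reachable x) (x , x∈X₀ , ε)

  Z-closed : ∀ {u v} → u ∈ Z → u ⟶ v → v ∈ Z
  Z-closed {u} {v} u∈Z u⟶v with to (∈Z⇔reachable u) u∈Z
  ... | x , x∈X₀ , x⟶⋆u = from (∈Z⇔reachable v) (x , x∈X₀ , x⟶⋆u ◅◅ (u⟶v ◅ ε))

  Z-induction : (P : Fin n → Set) → (∀ {x} → x ∈ X₀ → P x) →
                (∀ {u v} → u ∈ Z → P u → u ⟶ v → P v) → ∀ {v} → v ∈ Z → P v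
  Z-induction P base step {v} v∈Z with to (∈Z⇔reachable v) v∈Z
  ... | x , x∈X₀ , x⟶⋆v = fold (λ u w → u ∈ Z → P u → P w)
    (λ u⟶w continue u∈Z Pu → continue (Z-closed u∈Z u⟶w) (step u∈Z Pu u⟶w))
    (λ _ Pu → Pu) x⟶⋆v (X₀⊆Z x∈X₀) (base x∈X₀)

  partner-∈Z : ∀ {v} → v ∈ Z → partner v ∈ Z
  partner-∈Z {v} v∈Z with H⊎C v
  ... | inj₁ v∈H = Z-closed v∈Z (inj₁ (M-partner v , v∈H , partner-H H∌C M-between v∈H))
  ... | inj₂ v∈C = Z-induction (λ w → w ∈ C → partner w ∈ Z) base step v∈Z v∈C
    where
    base : ∀ {x} → x ∈ X₀ → x ∈ C → partner x ∈ Z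
    base {x} x∈X₀ x∈C = contradiction x∈C (H∌C x (X₀⊆H x∈X₀))
    step : ∀ {u w} → u ∈ Z → (u ∈ C → partner u ∈ Z) → u ⟶ w → w ∈ C → partner w ∈ Z
    step u∈Z _ (inj₁ (Muw , _)) _ = subst (_∈ Z) (M⇒≡partner (M-sym Muw)) u∈Z
    step _ _ (inj₂ (_ , _ , _ , w∈H)) w∈C = contradiction w∈C (H∌C _ w∈H)

  ∈F̄⇔partner∈F : ∀ {v} → v ∈ F̄ ⇔ partner v ∈ F
  ∈F̄⇔partner∈F {v} = mk⇔
    (λ v∈F̄ → let v∈Z , v∈C = x∈p∩q⁻ Z C v∈F̄ in
      x∈p∩q⁺ (partner-∈Z v∈Z , partner-C H∌C M-between v∈C))
    (λ pv∈F → let pv∈Z , pv∈H = x∈p∩q⁻ Z H pv∈F in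
      subst (_∈ F̄) (partner-involutive v) (x∈p∩q⁺ (partner-∈Z pv∈Z , partner-H H∌C M-between pv∈H)))

  F̄-image : IsImage M F F̄
  F̄-image v′ = mk⇔
    (λ v′∈F̄ → partner v′ , to ∈F̄⇔partner∈F v′∈F̄ , M-sym (M-partner v′))
    (λ (v , v∈F , Mvv′) → from ∈F̄⇔partner∈F (subst (_∈ F) (M⇒≡partner (M-sym Mvv′)) v∈F))

  ∣F̄∣≡∣F∣ : ∣ F̄ ∣ ≡ ∣ F ∣
  ∣F̄∣≡∣F∣ = ∣∣-permute partner-permutation (λ _ → ∈F̄⇔partner∈F)

  F̄-neighbour∈F : ∀ {u v} → u ∈ F̄ → _~_ G u v → v ∈ F
  F̄-neighbour∈F {u} {v} u∈F̄ u~v with x∈p∩q⁻ Z C u∈F̄ | H⊎C v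
  ... | _ , u∈C | inj₂ v∈C = contradiction u~v (indep u v u∈C v∈C)
  ... | u∈Z , u∈C | inj₁ v∈H with v ≟ partner u
  ...   | yes refl   = to ∈F̄⇔partner∈F u∈F̄
  ...   | no v≢pu = x∈p∩q⁺ (Z-closed u∈Z (inj₂ (u~v , v≢pu ∘ M⇒≡partner , u∈C , v∈H)) , v∈H)

  ∈V′⇔∉Z : ∀ {v} → v ∈ V′ ⇔ v ∉ Z
  ∈V′⇔∉Z {v} = mk⇔
    ([ (λ v∈H′ v∈Z → x∈p─q⇒x∉q H F v∈H′ (x∈p∩q⁺ (v∈Z , p─q⊆p H F v∈H′))) ,
      (λ v∈C′ v∈Z → x∈p─q⇒x∉q C F̄ v∈C′ (x∈p∩q⁺ (v∈Z , p─q⊆p C F̄ v∈C′))) ]′ ∘ x∈p∪q⁻ H′ C′)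
    (λ v∉Z → x∈p∪q⁺ (Sum.map (λ v∈H → x∈p∧x∉q⇒x∈p─q v∈H (v∉Z ∘ p∩q⊆p Z H))
                             (λ v∈C → x∈p∧x∉q⇒x∈p─q v∈C (v∉Z ∘ p∩q⊆p Z C)) (H⊎C v)))

  ∉V′⇒∈Z : ∀ {v} → v ∉ V′ → v ∈ Z
  ∉V′⇒∈Z {v} v∉V′ with v ∈? Z
  ... | yes v∈Z = v∈Z
  ... | no  v∉Z = contradiction (from ∈V′⇔∉Z v∉Z) v∉V′

  ∣H′∣+∣F∣≡∣H∣ : ∣ H′ ∣ + ∣ F ∣ ≡ ∣ H ∣
  ∣H′∣+∣F∣≡∣H∣ = Partition⇒∣p∣+∣q∣≡∣r∣ (⊆⇒Partition-─ (p∩q⊆q Z H))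

  ∣H′∣≡∣C′∣ : ∣ H ∣ ≡ ∣ C ∣ → ∣ H′ ∣ ≡ ∣ C′ ∣
  ∣H′∣≡∣C′∣ ∣H∣≡∣C∣ = +-cancelʳ-≡ (∣ F ∣) (∣ H′ ∣) (∣ C′ ∣) (begin
    ∣ H′ ∣ + ∣ F ∣  ≡⟨ ∣H′∣+∣F∣≡∣H∣ ⟩
    ∣ H ∣           ≡⟨ ∣H∣≡∣C∣ ⟩
    ∣ C ∣           ≡⟨ sym (Partition⇒∣p∣+∣q∣≡∣r∣ (⊆⇒Partition-─ (p∩q⊆q Z C))) ⟩
    ∣ C′ ∣ + ∣ F̄ ∣  ≡⟨ cong (∣ C′ ∣ +_) ∣F̄∣≡∣F∣ ⟩
    ∣ C′ ∣ + ∣ F ∣  ∎)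
    where open ≡-Reasoning

  SmallCrowned-V′ : ∣ H ∣ ≡ ∣ C ∣ → SmallCrowned G V′ H′ C′
  SmallCrowned-V′ ∣H∣≡∣C∣ =
    Crowned-restrict G H∌C indep isM M-between (p─q⊆p H F) (p─q⊆p C F̄) partner∈C′ , ∣H′∣≡∣C′∣ ∣H∣≡∣C∣
    where
    partner∈C′ : ∀ {h} → h ∈ H′ → ∃[ c ] (c ∈ C′ × M h c)
    partner∈C′ {h} h∈H′ = partner h ,
      x∈p∧x∉q⇒x∈p─q (partner-H H∌C M-between (p─q⊆p H F h∈H′))
        (λ ph∈F̄ → x∈p─q⇒x∉q H F h∈H′ (subst (_∈ F) (partner-involutive h) (to ∈F̄⇔partner∈F ph∈F̄))) ,
      M-partner h

  module Solution (∣H∣≡∣C∣ : ∣ H ∣ ≡ ∣ C ∣)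
    {S : Subset n} (S-cover : IsVertexCover G ⊤ S) (∣S∣≡∣H∣ : ∣ S ∣ ≡ ∣ H ∣) (X₀⊆S : X₀ ⊆ S) where

    ∣S∣+∣S∣≡n : ∣ S ∣ + ∣ S ∣ ≡ n
    ∣S∣+∣S∣≡n = begin
      ∣ S ∣ + ∣ S ∣  ≡⟨ cong₂ _+_ ∣S∣≡∣H∣ (trans ∣S∣≡∣H∣ ∣H∣≡∣C∣) ⟩
      ∣ H ∣ + ∣ C ∣  ≡⟨ Partition⇒∣p∣+∣q∣≡∣r∣ partition ⟩
      ∣ ⊤ {n} ∣      ≡⟨ ∣⊤∣≡n n ⟩
      n              ∎
      where open ≡-Reasoning

    partner∉S : ∀ {v} → v ∈ S → partner v ∉ S
    partner∉S = IsVertexCover⇒partner∉ S-cover (≤-reflexive ∣S∣+∣S∣≡n)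

    Z-sides : ∀ {v} → v ∈ Z → (v ∈ H → v ∈ S) × (v ∈ C → v ∉ S)
    Z-sides = Z-induction _ base step
      where
      base : ∀ {x} → x ∈ X₀ → (x ∈ H → x ∈ S) × (x ∈ C → x ∉ S)
      base {x} x∈X₀ = (λ _ → X₀⊆S x∈X₀) , (λ x∈C _ → H∌C x (X₀⊆H x∈X₀) x∈C)
      step : ∀ {u v} → u ∈ Z → (u ∈ H → u ∈ S) × (u ∈ C → u ∉ S) → u ⟶ v →
             (v ∈ H → v ∈ S) × (v ∈ C → v ∉ S)
      step _ (H⇒∈S , _) (inj₁ (Muv , u∈H , v∈C)) =
        (λ v∈H → contradiction v∈C (H∌C _ v∈H)) ,
        (λ _ v∈S → partner∉S (H⇒∈S u∈H) (subst (_∈ S) (M⇒≡partner Muv) v∈S))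
      step {u} {v} _ (_ , C⇒∉S) (inj₂ (u~v , _ , u∈C , v∈H)) =
        (λ _ → [ (λ u∈S → contradiction u∈S (C⇒∉S u∈C)) , id ]′ (proj₂ S-cover u v ∈⊤ ∈⊤ u~v)) ,
        (λ v∈C → contradiction v∈C (H∌C v v∈H))

    F⊆S : F ⊆ S
    F⊆S v∈F = let v∈Z , v∈H = x∈p∩q⁻ Z H v∈F in proj₁ (Z-sides v∈Z) v∈H

    ∈S⇒∉F̄ : ∀ v → v ∈ S → v ∉ F̄
    ∈S⇒∉F̄ v v∈S v∈F̄ = let v∈Z , v∈C = x∈p∩q⁻ Z C v∈F̄ in proj₂ (Z-sides v∈Z) v∈C v∈S

    Partition-S : Partition S (S ∩ V′) F
    Partition-S = (λ v → mk⇔ (split v) [ p∩q⊆p S V′ , F⊆S ]′) ,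
                  (λ v v∈S∩V′ → to ∈V′⇔∉Z (p∩q⊆q S V′ v∈S∩V′) ∘ p∩q⊆p Z H)
      where
      split : ∀ v → v ∈ S → v ∈ S ∩ V′ ⊎ v ∈ F
      split v v∈S with v ∈? Z | H⊎C v
      ... | no  v∉Z | _        = inj₁ (x∈p∩q⁺ (v∈S , from ∈V′⇔∉Z v∉Z))
      ... | yes v∈Z | inj₁ v∈H = inj₂ (x∈p∩q⁺ (v∈Z , v∈H))
      ... | yes v∈Z | inj₂ v∈C = contradiction v∈S (proj₂ (Z-sides v∈Z) v∈C)

    Sol-V′ : Sol G V′ H′ (S ∩ V′)
    Sol-V′ = IsVertexCover-∩ G S-cover ⊆⊤ , +-cancelʳ-≡ (∣ F ∣) (∣ S ∩ V′ ∣) (∣ H′ ∣) (begin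
      ∣ S ∩ V′ ∣ + ∣ F ∣  ≡⟨ Partition⇒∣p∣+∣q∣≡∣r∣ Partition-S ⟩
      ∣ S ∣               ≡⟨ ∣S∣≡∣H∣ ⟩
      ∣ H ∣               ≡⟨ sym ∣H′∣+∣F∣≡∣H∣ ⟩
      ∣ H′ ∣ + ∣ F ∣      ∎)
      where open ≡-Reasoning

  module Extension {S′ : Subset n} (S′-cover : IsVertexCover G V′ S′) (∣S′∣≡∣H′∣ : ∣ S′ ∣ ≡ ∣ H′ ∣) where

    Sol-F∪S′ : Sol G ⊤ H (F ∪ S′)
    Sol-F∪S′ = IsVertexCover-∪ G S′-cover leaving , (begin
      ∣ F ∪ S′ ∣      ≡⟨ ∣p∪q∣≡∣p∣+∣q∣ F S′ F∩S′-empty ⟩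
      ∣ F ∣ + ∣ S′ ∣  ≡⟨ cong (∣ F ∣ +_) ∣S′∣≡∣H′∣ ⟩
      ∣ F ∣ + ∣ H′ ∣  ≡⟨ +-comm ∣ F ∣ ∣ H′ ∣ ⟩
      ∣ H′ ∣ + ∣ F ∣  ≡⟨ ∣H′∣+∣F∣≡∣H∣ ⟩
      ∣ H ∣           ∎)
      where
      open ≡-Reasoning
      leaving : ∀ {u v} → u ∉ V′ → _~_ G u v → u ∈ F ⊎ v ∈ F
      leaving {u} u∉V′ u~v with H⊎C u
      ... | inj₁ u∈H = inj₁ (x∈p∩q⁺ (∉V′⇒∈Z u∉V′ , u∈H))
      ... | inj₂ u∈C = inj₂ (F̄-neighbour∈F (x∈p∩q⁺ (∉V′⇒∈Z u∉V′ , u∈C)) u~v)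
      F∩S′-empty : Empty (F ∩ S′)
      F∩S′-empty (v , v∈F∩S′) =
        to ∈V′⇔∉Z (proj₁ S′-cover (p∩q⊆q F S′ v∈F∩S′)) (p∩q⊆p Z H (p∩q⊆p F S′ v∈F∩S′))

    X₀⊆F∪S′ : X₀ ⊆ F ∪ S′
    X₀⊆F∪S′ x∈X₀ = x∈p∪q⁺ (inj₁ (x∈p∩q⁺ (X₀⊆Z x∈X₀ , X₀⊆H x∈X₀)))

lemma11 : {n : ℕ} (G : Graph n) (H C : Subset n) →
    SmallCrowned G ⊤ H C →
    (M : EdgeSet n) → IsMatching G M → BetweenHC M H C → Saturates M ⊤ →
    (X₀ : Subset n) → X₀ ⊆ H →
    (F F̄ : Subset n) → PropDir G M H C X₀ F F̄ →
    -- (1)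
    (F ⊆ H × F̄ ⊆ C × IsImage M F F̄ ×
      (∀ S → Sol G ⊤ H S → X₀ ⊆ S → F ⊆ S × (∀ v → v ∈ S → v ∉ F̄)))
    -- (2)  with H' = H ─ F, C' = C ─ F̄, G' = G[H' ∪ C']
    × (∀ S → Sol G ⊤ H S → X₀ ⊆ S →
         SmallCrowned G ((H ─ F) ∪ (C ─ F̄)) (H ─ F) (C ─ F̄) ×
         Sol G ((H ─ F) ∪ (C ─ F̄)) (H ─ F) (S ∩ ((C ─ F̄) ∪ (H ─ F))))
    -- (3)
    × (∀ S' → Sol G ((H ─ F) ∪ (C ─ F̄)) (H ─ F) S' →
         Sol G ⊤ H (F ∪ S') × X₀ ⊆ (F ∪ S'))
lemma11 G H C ((partition , indep , _) , ∣H∣≡∣C∣) M isM M-between saturated X₀ X₀⊆H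
        _ _ (Z , ∈Z⇔reachable , refl , refl) =
  (p∩q⊆q Z H , p∩q⊆q Z C , F̄-image ,
   λ S (S-cover , ∣S∣≡∣H∣) X₀⊆S → let open Solution ∣H∣≡∣C∣ S-cover ∣S∣≡∣H∣ X₀⊆S in F⊆S , ∈S⇒∉F̄) ,
  (λ S (S-cover , ∣S∣≡∣H∣) X₀⊆S → let open Solution ∣H∣≡∣C∣ S-cover ∣S∣≡∣H∣ X₀⊆S in
     SmallCrowned-V′ ∣H∣≡∣C∣ , subst (Sol G V′ H′ ∘ (S ∩_)) (∪-comm H′ C′) Sol-V′) ,
  λ S′ (S′-cover , ∣S′∣≡∣H′∣) → let open Extension S′-cover ∣S′∣≡∣H′∣ in Sol-F∪S′ , X₀⊆F∪S′
  where open PropDirProperties partition indep isM M-between saturated X₀⊆H ∈Z⇔reachable
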